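{- Let $T:\mathbb{Z}_{>0}\to\mathbb{Z}_{>0}$ be the map $T(x)=x/2$ if $x$ is even and $T(x)=(3x+1)/2$ if $x$ is odd, with iterates $T^j$ ($T^0=\mathrm{id}$). Let $M\ge 2$ and $\Gamma_M=\{1,2,\dots,2^M\}$, and let $x_0$ be chosen uniformly at random from $\Gamma_M$. For $1\le k\le M-1$ let $A_k=P\big(T^k(x_0)>T^{k-1}(x_0)\big)$ and $B_k=P\big(T^k(x_0)<T^{k-1}(x_0)\big)$. Then $A_k=B_k=\tfrac12$ for every $k$ with $1\le k\le M-1$. -}

module Defs where

open import Data.Nat using (ℕ; zero; suc; _+_; _*_; _^_; _<_; _<?_; _%_; _/_)
open import Data.Nat.Properties using (_≟_)
open import Data.List using (List; length; filter; map; upTo)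
open import Relation.Nullary using (yes; no)

T : ℕ → ℕ
T x with x % 2 ≟ 0
... | yes _ = x / 2
... | no _ = (3 * x + 1) / 2

iter : ℕ → ℕ → ℕ
iter zero    x = x
iter (suc j) x = T (iter j x)

Γ : ℕ → List ℕ
Γ M = map suc (upTo (2 ^ M))

-- number of x₀ ∈ Γ_M with T^k(x₀) > T^(k-1)(x₀), for k = suc j
countUp : ℕ → ℕ → ℕ
countUp M j = length (filter (λ x → iter j x <? iter (suc j) x) (Γ M))

-- number of x₀ ∈ Γ_M with T^k(x₀) < T^(k-1)(x₀), for k = suc j
countDown : ℕ → ℕ → ℕ
countDown M j = length (filter (λ x → iter (suc j) x <? iter j x) (Γ M))

-- On positive numbers T rises exactly at the odd ones (T x = (3x+1)/2 > x)
-- and falls exactly at the even ones (T x = x/2 < x).  Hence, writing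
-- k = j + 1, the x₀ ∈ Γ_M with T^k x₀ > T^j x₀ are those with T^j x₀ odd,
-- and the falls are those with T^j x₀ even.  Terras' shift lemma says
-- T^j (x + m·2^j) = T^j x + m·w with a weight w that is a product of
-- factors 1 and 3, hence odd; so shifting the start by 2^j flips the parity
-- of T^j x.  A Boolean sequence that flips under a shift by p is true on
-- exactly half of every block of length 2p, and for j < M the interval
-- [0, 2^M) is a union of blocks of length 2^(j+1).
module Submission where

open import Defs
open import Data.Bool.Base using (Bool; true; false; not)
open import Data.Bool.Properties using (not-involutive)
open import Data.Empty using (⊥-elim)
open import Data.List.Base using (length; filter; applyUpTo)
open import Data.List.Properties using (map-upTo)
open import Data.Nat.Base
  using (ℕ; zero; suc; _+_; _*_; _^_; _∸_; _≤_; _<_; _%_; _/_; z≤n; s≤s; parity)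
open import Data.Nat.DivMod using (m*n%n≡0; m*n/n≡m; [m+kn]%n≡m%n)
open import Data.Nat.Properties
  using (*-comm; *-assoc; *-identityˡ; *-distribˡ-+; +-comm; +-assoc; +-identityʳ;
         ≤-trans; <-asym; 1+n≰n; m≤m+n; m≤n+m; m<m+n; m∸n≤m; m∸n+n≡m; ^-distribˡ-+-*; 0≢1+n; _≟_; _<?_)
open import Data.Nat.Tactic.RingSolver using (solve-∀)
open import Data.Parity.Base as ℙ using (Parity; 0ℙ; 1ℙ; _⁻¹)
import Data.Parity.Properties as ℙ
open import Data.Product.Base using (_×_; _,_)
open import Relation.Nullary using (yes; no; does)
open import Relation.Nullary.Decidable using (dec-true; dec-false)
open import Relation.Unary using (Pred; Decidable)
open import Relation.Binary.PropositionalEquality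
open ≡-Reasoning

data EvenOdd : ℕ → Set where
  even : ∀ h → EvenOdd (2 * h)
  odd  : ∀ h → EvenOdd (1 + 2 * h)

evenOdd : ∀ n → EvenOdd n
evenOdd zero = even 0
evenOdd (suc n) with evenOdd n
... | even h = odd h
... | odd h  = subst EvenOdd (*-distribˡ-+ 2 1 h) (even (suc h))

T-on-%0 : ∀ x → x % 2 ≡ 0 → T x ≡ x / 2
T-on-%0 x x%2≡0 with x % 2 ≟ 0
... | yes _     = refl
... | no x%2≢0 = ⊥-elim (x%2≢0 x%2≡0)

T-on-%1 : ∀ x → x % 2 ≡ 1 → T x ≡ (3 * x + 1) / 2
T-on-%1 x x%2≡1 with x % 2 ≟ 0
... | yes x%2≡0 = ⊥-elim (0≢1+n (trans (sym x%2≡0) x%2≡1))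
... | no _      = refl

T-even : ∀ h → T (2 * h) ≡ h
T-even h = begin
  T (2 * h)  ≡⟨ cong T (*-comm 2 h) ⟩
  T (h * 2)  ≡⟨ T-on-%0 (h * 2) (m*n%n≡0 h 2) ⟩
  h * 2 / 2  ≡⟨ m*n/n≡m h 2 ⟩
  h          ∎

T-odd : ∀ h → T (1 + 2 * h) ≡ 3 * h + 2
T-odd h = begin
  T (1 + 2 * h)              ≡⟨ cong (λ y → T (1 + y)) (*-comm 2 h) ⟩
  T (1 + h * 2)              ≡⟨ T-on-%1 (1 + h * 2) ([m+kn]%n≡m%n 1 h 2) ⟩
  (3 * (1 + h * 2) + 1) / 2  ≡⟨ cong (_/ 2) (numerator h) ⟩
  (3 * h + 2) * 2 / 2        ≡⟨ m*n/n≡m (3 * h + 2) 2 ⟩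
  3 * h + 2                  ∎
  where
  numerator : ∀ h → 3 * (1 + h * 2) + 1 ≡ (3 * h + 2) * 2
  numerator = solve-∀

parity-even : ∀ h → parity (2 * h) ≡ 0ℙ
parity-even h = ℙ.*-homo-* 2 h

parity-odd : ∀ h → parity (1 + 2 * h) ≡ 1ℙ
parity-odd h = trans (ℙ.+-homo-+ 1 (2 * h)) (cong _⁻¹ (parity-even h))

T-positive : ∀ x → 1 ≤ x → 1 ≤ T x
T-positive x 1≤x with evenOdd x
... | even zero    = ⊥-elim (1+n≰n 1≤x)
... | even (suc h) = subst (1 ≤_) (sym (T-even (suc h))) (s≤s z≤n)
... | odd h        = subst (1 ≤_) (sym (T-odd h)) (≤-trans (s≤s z≤n) (m≤n+m 2 (3 * h)))

iter-positive : ∀ j x → 1 ≤ x → 1 ≤ iter j x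
iter-positive zero    x 1≤x = 1≤x
iter-positive (suc j) x 1≤x = T-positive (iter j x) (iter-positive j x 1≤x)

isOdd : Parity → Bool
isOdd 0ℙ = false
isOdd 1ℙ = true

isOdd-⁻¹ : ∀ p → isOdd (p ⁻¹) ≡ not (isOdd p)
isOdd-⁻¹ 0ℙ = refl
isOdd-⁻¹ 1ℙ = refl

T-falls-on-even : ∀ h → T (2 * suc h) < 2 * suc h
T-falls-on-even h = subst (_< 2 * suc h) (sym (T-even (suc h))) (m<m+n (suc h) (s≤s z≤n))

T-rises-on-odd : ∀ h → 1 + 2 * h < T (1 + 2 * h)
T-rises-on-odd h = subst (2 + 2 * h ≤_) (sym (trans (T-odd h) (rearrange h))) (m≤m+n (2 + 2 * h) h)
  where
  rearrange : ∀ h → 3 * h + 2 ≡ 2 + 2 * h + h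
  rearrange = solve-∀

rises-iff-odd : ∀ x → 1 ≤ x → does (x <? T x) ≡ isOdd (parity x)
rises-iff-odd x 1≤x with evenOdd x
... | even zero    = ⊥-elim (1+n≰n 1≤x)
... | even (suc h) rewrite parity-even (suc h) =
  dec-false (2 * suc h <? T (2 * suc h)) (<-asym (T-falls-on-even h))
... | odd h rewrite parity-odd h = dec-true (1 + 2 * h <? T (1 + 2 * h)) (T-rises-on-odd h)

falls-iff-even : ∀ x → 1 ≤ x → does (T x <? x) ≡ not (isOdd (parity x))
falls-iff-even x 1≤x with evenOdd x
... | even zero    = ⊥-elim (1+n≰n 1≤x)
... | even (suc h) rewrite parity-even (suc h) =
  dec-true (T (2 * suc h) <? 2 * suc h) (T-falls-on-even h)
... | odd h rewrite parity-odd h = dec-false (T (1 + 2 * h) <? 1 + 2 * h) (<-asym (T-rises-on-odd h))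

-- The factor by which T stretches a shift by an even amount at a point of
-- parity p:  T (y + 2c) = T y + slope (parity y) · c.
slope : Parity → ℕ
slope 0ℙ = 1
slope 1ℙ = 3

T-shift : ∀ y c → T (y + 2 * c) ≡ T y + slope (parity y) * c
T-shift y c with evenOdd y
... | even h rewrite parity-even h = begin
  T (2 * h + 2 * c)  ≡⟨ cong T (sym (*-distribˡ-+ 2 h c)) ⟩
  T (2 * (h + c))    ≡⟨ T-even (h + c) ⟩
  h + c              ≡⟨ cong₂ _+_ (sym (T-even h)) (sym (*-identityˡ c)) ⟩
  T (2 * h) + 1 * c  ∎
... | odd h rewrite parity-odd h = begin
  T (1 + 2 * h + 2 * c)  ≡⟨ cong (λ z → T (1 + z)) (sym (*-distribˡ-+ 2 h c)) ⟩
  T (1 + 2 * (h + c))    ≡⟨ T-odd (h + c) ⟩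
  3 * (h + c) + 2        ≡⟨ rearrange h c ⟩
  3 * h + 2 + 3 * c      ≡⟨ cong (_+ 3 * c) (sym (T-odd h)) ⟩
  T (1 + 2 * h) + 3 * c  ∎
  where
  rearrange : ∀ h c → 3 * (h + c) + 2 ≡ 3 * h + 2 + 3 * c
  rearrange = solve-∀

weight : ℕ → ℕ → ℕ
weight zero    x = 1
weight (suc j) x = slope (parity (iter j x)) * weight j x

iter-shift : ∀ j x m → iter j (x + m * 2 ^ j) ≡ iter j x + m * weight j x
iter-shift zero    x m = refl
iter-shift (suc j) x m = begin
  T (iter j (x + m * (2 * 2 ^ j)))          ≡⟨ cong (λ z → T (iter j (x + z))) (sym (*-assoc m 2 (2 ^ j))) ⟩
  T (iter j (x + m * 2 * 2 ^ j))            ≡⟨ cong T (iter-shift j x (m * 2)) ⟩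
  T (iter j x + m * 2 * weight j x)         ≡⟨ cong (λ z → T (iter j x + z)) (pull-2 m (weight j x)) ⟩
  T (iter j x + 2 * (m * weight j x))       ≡⟨ T-shift (iter j x) (m * weight j x) ⟩
  T (iter j x) + s * (m * weight j x)       ≡⟨ cong (T (iter j x) +_) (swap s m (weight j x)) ⟩
  T (iter j x) + m * (s * weight j x)       ∎
  where
  s : ℕ
  s = slope (parity (iter j x))
  pull-2 : ∀ m w → m * 2 * w ≡ 2 * (m * w)
  pull-2 = solve-∀
  swap : ∀ s m w → s * (m * w) ≡ m * (s * w)
  swap = solve-∀

weight-odd : ∀ j x → parity (weight j x) ≡ 1ℙ
weight-odd zero    x = refl
weight-odd (suc j) x = begin
  parity (slope p * weight j x)             ≡⟨ ℙ.*-homo-* (slope p) (weight j x) ⟩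
  parity (slope p) ℙ.* parity (weight j x)  ≡⟨ cong₂ ℙ._*_ (slope-odd p) (weight-odd j x) ⟩
  1ℙ                                        ∎
  where
  p : Parity
  p = parity (iter j x)
  slope-odd : ∀ p → parity (slope p) ≡ 1ℙ
  slope-odd 0ℙ = refl
  slope-odd 1ℙ = refl

parity-flip : ∀ j x → parity (iter j (x + 2 ^ j)) ≡ parity (iter j x) ⁻¹
parity-flip j x = begin
  parity (iter j (x + 2 ^ j))                    ≡⟨ cong (λ z → parity (iter j (x + z))) (sym (*-identityˡ (2 ^ j))) ⟩
  parity (iter j (x + 1 * 2 ^ j))                ≡⟨ cong parity (iter-shift j x 1) ⟩
  parity (iter j x + 1 * weight j x)             ≡⟨ ℙ.+-homo-+ (iter j x) (1 * weight j x) ⟩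
  parity (iter j x) ℙ.+ parity (1 * weight j x)  ≡⟨ cong (parity (iter j x) ℙ.+_) shifted-odd ⟩
  parity (iter j x) ℙ.+ 1ℙ                       ≡⟨ ℙ.+-comm (parity (iter j x)) 1ℙ ⟩
  parity (iter j x) ⁻¹                           ∎
  where
  shifted-odd : parity (1 * weight j x) ≡ 1ℙ
  shifted-odd = trans (cong parity (*-identityˡ (weight j x))) (weight-odd j x)

indicator : Bool → ℕ
indicator true  = 1
indicator false = 0

count : (ℕ → Bool) → ℕ → ℕ
count f zero    = 0
count f (suc n) = indicator (f 0) + count (λ i → f (suc i)) n

count-cong : ∀ {f g} n → (∀ i → f i ≡ g i) → count f n ≡ count g n
count-cong zero    f≗g = refl
count-cong (suc n) f≗g = cong₂ _+_ (cong indicator (f≗g 0)) (count-cong n (λ i → f≗g (suc i)))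

count-+ : ∀ f m n → count f (m + n) ≡ count f m + count (λ i → f (m + i)) n
count-+ f zero    n = refl
count-+ f (suc m) n = trans (cong (indicator (f 0) +_) (count-+ (λ i → f (suc i)) m n))
                            (sym (+-assoc (indicator (f 0)) _ _))

count-not : ∀ f n → count f n + count (λ i → not (f i)) n ≡ n
count-not f zero    = refl
count-not f (suc n) = begin
  (a + c) + (b + d)  ≡⟨ interchange a b c d ⟩
  (a + b) + (c + d)  ≡⟨ cong₂ _+_ (indicator-not (f 0)) (count-not (λ i → f (suc i)) n) ⟩
  1 + n              ∎
  where
  a b c d : ℕ
  a = indicator (f 0)
  b = indicator (not (f 0))
  c = count (λ i → f (suc i)) n
  d = count (λ i → not (f (suc i))) n
  interchange : ∀ a b c d → (a + c) + (b + d) ≡ (a + b) + (c + d)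
  interchange = solve-∀
  indicator-not : ∀ x → indicator x + indicator (not x) ≡ 1
  indicator-not false = refl
  indicator-not true  = refl

count-periodic : ∀ f q → (∀ i → f (q + i) ≡ f i) → ∀ r → count f (r * q) ≡ r * count f q
count-periodic f q periodic zero    = refl
count-periodic f q periodic (suc r) = begin
  count f (q + r * q)                              ≡⟨ count-+ f q (r * q) ⟩
  count f q + count (λ i → f (q + i)) (r * q)     ≡⟨ cong (count f q +_) (count-cong (r * q) periodic) ⟩
  count f q + count f (r * q)                      ≡⟨ cong (count f q +_) (count-periodic f q periodic r) ⟩
  count f q + r * count f q                        ∎

Antiperiodic : ℕ → (ℕ → Bool) → Set
Antiperiodic p f = ∀ i → f (p + i) ≡ not (f i)

antiperiodic-not : ∀ {p f} → Antiperiodic p f → Antiperiodic p (λ i → not (f i))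
antiperiodic-not anti i = cong not (anti i)

antiperiodic⇒periodic : ∀ {p f} → Antiperiodic p f → ∀ i → f (2 * p + i) ≡ f i
antiperiodic⇒periodic {p} {f} anti i = begin
  f (2 * p + i)      ≡⟨ cong f (trans (cong (_+ i) (cong (p +_) (+-identityʳ p))) (+-assoc p p i)) ⟩
  f (p + (p + i))    ≡⟨ anti (p + i) ⟩
  not (f (p + i))    ≡⟨ cong not (anti i) ⟩
  not (not (f i))    ≡⟨ not-involutive (f i) ⟩
  f i                ∎

count-antiperiod : ∀ {p f} → Antiperiodic p f → count f (2 * p) ≡ p
count-antiperiod {p} {f} anti = begin
  count f (2 * p)                                   ≡⟨ cong (count f) (cong (p +_) (+-identityʳ p)) ⟩
  count f (p + p)                                   ≡⟨ count-+ f p p ⟩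
  count f p + count (λ i → f (p + i)) p             ≡⟨ cong (count f p +_) (count-cong p anti) ⟩
  count f p + count (λ i → not (f i)) p             ≡⟨ count-not f p ⟩
  p                                                 ∎

half-on-power : ∀ {j M f} → suc j ≤ M → Antiperiodic (2 ^ j) f → 2 * count f (2 ^ M) ≡ 2 ^ M
half-on-power {j} {M} {f} j<M anti = begin
  2 * count f (2 ^ M)           ≡⟨ cong (λ n → 2 * count f n) blocks ⟩
  2 * count f (r * (2 * p))     ≡⟨ cong (2 *_) (count-periodic f (2 * p) (antiperiodic⇒periodic anti) r) ⟩
  2 * (r * count f (2 * p))     ≡⟨ cong (λ c → 2 * (r * c)) (count-antiperiod anti) ⟩
  2 * (r * p)                   ≡⟨ swap r p ⟩
  r * (2 * p)                   ≡⟨ sym blocks ⟩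
  2 ^ M                         ∎
  where
  p r : ℕ
  p = 2 ^ j
  r = 2 ^ (M ∸ suc j)
  blocks : 2 ^ M ≡ r * 2 ^ suc j
  blocks = trans (cong (2 ^_) (sym (m∸n+n≡m j<M))) (^-distribˡ-+-* 2 (M ∸ suc j) (suc j))
  swap : ∀ r p → 2 * (r * p) ≡ r * (2 * p)
  swap = solve-∀

length-filter-applyUpTo : ∀ {a ℓ} {A : Set a} {P : Pred A ℓ} (P? : Decidable P) (g : ℕ → A) n →
  length (filter P? (applyUpTo g n)) ≡ count (λ i → does (P? (g i))) n
length-filter-applyUpTo P? g zero = refl
length-filter-applyUpTo P? g (suc n) with does (P? (g 0))
... | true  = cong suc (length-filter-applyUpTo P? (λ i → g (suc i)) n)
... | false = length-filter-applyUpTo P? (λ i → g (suc i)) n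

iterParity : ℕ → ℕ → Bool
iterParity j i = isOdd (parity (iter j (suc i)))

iterParity-antiperiodic : ∀ j → Antiperiodic (2 ^ j) (iterParity j)
iterParity-antiperiodic j i = begin
  isOdd (parity (iter j (suc (2 ^ j + i))))  ≡⟨ cong (λ z → isOdd (parity (iter j (suc z)))) (+-comm (2 ^ j) i) ⟩
  isOdd (parity (iter j (suc i + 2 ^ j)))    ≡⟨ cong isOdd (parity-flip j (suc i)) ⟩
  isOdd (parity (iter j (suc i)) ⁻¹)         ≡⟨ isOdd-⁻¹ (parity (iter j (suc i))) ⟩
  not (iterParity j i)                       ∎

countUp-odd : ∀ M j → countUp M j ≡ count (iterParity j) (2 ^ M)
countUp-odd M j = begin
  countUp M j                                            ≡⟨ cong (λ xs → length (filter rises? xs)) (map-upTo suc (2 ^ M)) ⟩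
  length (filter rises? (applyUpTo suc (2 ^ M)))        ≡⟨ length-filter-applyUpTo rises? suc (2 ^ M) ⟩
  count (λ i → does (rises? (suc i))) (2 ^ M)           ≡⟨ count-cong (2 ^ M) rise-is-odd ⟩
  count (iterParity j) (2 ^ M)                          ∎
  where
  rises? : Decidable (λ x → iter j x < iter (suc j) x)
  rises? x = iter j x <? iter (suc j) x
  rise-is-odd : ∀ i → does (rises? (suc i)) ≡ iterParity j i
  rise-is-odd i = rises-iff-odd (iter j (suc i)) (iter-positive j (suc i) (s≤s z≤n))

countDown-even : ∀ M j → countDown M j ≡ count (λ i → not (iterParity j i)) (2 ^ M)
countDown-even M j = begin
  countDown M j                                          ≡⟨ cong (λ xs → length (filter falls? xs)) (map-upTo suc (2 ^ M)) ⟩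
  length (filter falls? (applyUpTo suc (2 ^ M)))        ≡⟨ length-filter-applyUpTo falls? suc (2 ^ M) ⟩
  count (λ i → does (falls? (suc i))) (2 ^ M)           ≡⟨ count-cong (2 ^ M) fall-is-even ⟩
  count (λ i → not (iterParity j i)) (2 ^ M)            ∎
  where
  falls? : Decidable (λ x → iter (suc j) x < iter j x)
  falls? x = iter (suc j) x <? iter j x
  fall-is-even : ∀ i → does (falls? (suc i)) ≡ not (iterParity j i)
  fall-is-even i = falls-iff-even (iter j (suc i)) (iter-positive j (suc i) (s≤s z≤n))

theorem10 : (M k : ℕ) → 2 ≤ M → 1 ≤ k → k ≤ M ∸ 1 →
    (2 * countUp M (k ∸ 1) ≡ 2 ^ M) × (2 * countDown M (k ∸ 1) ≡ 2 ^ M)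
theorem10 M zero    _ () _
theorem10 M (suc j) _ _  k≤M∸1 =
    trans (cong (2 *_) (countUp-odd M j)) (half-on-power j<M (iterParity-antiperiodic j))
  , trans (cong (2 *_) (countDown-even M j))
          (half-on-power j<M (antiperiodic-not (iterParity-antiperiodic j)))
  where
  j<M : suc j ≤ M
  j<M = ≤-trans k≤M∸1 (m∸n≤m M 1)
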